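{- Let $n\ge3$. Over finite simple graphs $G$ of order $n$, the second-largest value of $q(G;1)$ is $\frac34 2^{n-1}$, and it is achieved exactly when $G$ is the union of two complete graphs sharing some but not all of their vertices; equivalently, $V(G)=V_1\cup V_2\cup V_3$ with $V_1,V_2,V_3$ nonempty and pairwise disjoint, $V_1\cup V_2$ and $V_2\cup V_3$ inducing complete graphs, and no edges between $V_1$ and $V_3$.
   Context: The interlace polynomial $q$ is the unique map from finite simple graphs to $\mathbb{Z}[x]$ with $q(E_n)=x^n$ for the edgeless graph $E_n$ on $n$ vertices and $q(G)=q(G-a)+q(G^{ab}-b)$ for every edge $ab$ of $G$; here the pivot $G^{ab}$ is obtained by partitioning the vertices other than $a,b$ into (1) adjacent to $a$ only, (2) adjacent to $b$ only, (3) adjacent to both, (4) adjacent to neither, and toggling the adjacency of every pair $\{x,y\}$ with $x,y$ in two different classes among (1),(2),(3). -}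

module Defs where

open import Data.Nat using (ℕ; zero; suc)
open import Data.Bool using (Bool; true; false; _∧_; _xor_; not)
open import Data.Bool.Properties using (∧-comm; ∧-zeroʳ)
open import Data.Fin using (Fin; punchIn; _≟_)
open import Data.Integer using (ℤ; _+_; 0ℤ; 1ℤ)
open import Data.List using (List; []; _∷_; replicate; _++_; foldr)
open import Data.Product using (Σ; _×_; ∃)
open import Relation.Nullary using (¬_)
open import Relation.Nullary.Decidable using (⌊_⌋)
open import Relation.Binary.PropositionalEquality using (_≡_; refl; cong₂; subst)

record Graph (n : ℕ) : Set where
  field
    adj    : Fin n → Fin n → Bool
    sym    : ∀ i j → adj i j ≡ adj j i
    irrefl : ∀ i → adj i i ≡ false
open Graph public

Edgeless : ∀ {n} → Graph n → Set
Edgeless G = ∀ i j → adj G i j ≡ false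

_─_ : ∀ {n} → Graph (suc n) → Fin (suc n) → Graph n
adj    (G ─ a) i j = adj G (punchIn a i) (punchIn a j)
sym    (G ─ a) i j = sym G (punchIn a i) (punchIn a j)
irrefl (G ─ a) i   = irrefl G (punchIn a i)

-- toggleCls pa pb qa qb : given (adj to a, adj to b) of x and of y,
-- true iff x, y lie in two different classes among (1),(2),(3)
toggleCls : Bool → Bool → Bool → Bool → Bool
toggleCls false false _     _     = false
toggleCls _     _     false false = false
toggleCls true  false true  false = false
toggleCls false true  false true  = false
toggleCls true  true  true  true  = false
toggleCls _     _     _     _     = true

toggleCls-sym : ∀ p q r s → toggleCls p q r s ≡ toggleCls r s p q
toggleCls-sym false false false false = refl
toggleCls-sym false false false true  = refl
toggleCls-sym false false true  false = refl
toggleCls-sym false false true  true  = refl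
toggleCls-sym false true  false false = refl
toggleCls-sym false true  false true  = refl
toggleCls-sym false true  true  false = refl
toggleCls-sym false true  true  true  = refl
toggleCls-sym true  false false false = refl
toggleCls-sym true  false false true  = refl
toggleCls-sym true  false true  false = refl
toggleCls-sym true  false true  true  = refl
toggleCls-sym true  true  false false = refl
toggleCls-sym true  true  false true  = refl
toggleCls-sym true  true  true  false = refl
toggleCls-sym true  true  true  true  = refl

toggleCls-refl : ∀ p q → toggleCls p q p q ≡ false
toggleCls-refl false false = refl
toggleCls-refl false true  = refl
toggleCls-refl true  false = refl
toggleCls-refl true  true  = refl

xorLemma : ∀ c {d t} → d ≡ false → t ≡ false → (d xor (c ∧ t)) ≡ false
xorLemma c refl refl rewrite ∧-zeroʳ c = refl

pivot : ∀ {n} → Graph n → Fin n → Fin n → Graph n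
pivot {n} G a b = record { adj = A ; sym = S ; irrefl = I }
  where
  other : Fin n → Bool
  other x = not ⌊ x ≟ a ⌋ ∧ not ⌊ x ≟ b ⌋
  T : Fin n → Fin n → Bool
  T x y = (other x ∧ other y) ∧ toggleCls (adj G a x) (adj G b x) (adj G a y) (adj G b y)
  A : Fin n → Fin n → Bool
  A x y = adj G x y xor T x y
  TS : ∀ x y → T x y ≡ T y x
  TS x y = cong₂ _∧_ (∧-comm (other x) (other y))
                     (toggleCls-sym (adj G a x) (adj G b x) (adj G a y) (adj G b y))
  S : ∀ x y → A x y ≡ A y x
  S x y = cong₂ _xor_ (sym G x y) (TS x y)
  I : ∀ x → A x x ≡ false
  I x = xorLemma (other x ∧ other x) (irrefl G x) (toggleCls-refl (adj G a x) (adj G b x))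

-- Polynomials in ℤ[x] as coefficient lists (lowest degree first),
-- compared coefficientwise (so trailing zeros are irrelevant)

Poly : Set
Poly = List ℤ

coeff : Poly → ℕ → ℤ
coeff []       _       = 0ℤ
coeff (c ∷ p)  zero    = c
coeff (c ∷ p)  (suc i) = coeff p i

_≈ₚ_ : Poly → Poly → Set
p ≈ₚ r = ∀ i → coeff p i ≡ coeff r i

_+ₚ_ : Poly → Poly → Poly
[]      +ₚ r       = r
(c ∷ p) +ₚ []      = c ∷ p
(c ∷ p) +ₚ (d ∷ r) = (c + d) ∷ (p +ₚ r)

X^ : ℕ → Poly
X^ n = replicate n 0ℤ ++ (1ℤ ∷ [])

eval1 : Poly → ℤ
eval1 = foldr _+_ 0ℤ

-- q is an interlace polynomial: q(E_n) = x^n and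
-- q(G) = q(G - a) + q(G^{ab} - b) for every edge ab of G.
-- (By induction on n, these conditions determine q uniquely.)

IsInterlace : (∀ n → Graph n → Poly) → Set
IsInterlace q =
    (∀ n (G : Graph n) → Edgeless G → q n G ≈ₚ X^ n)
  × (∀ n (G : Graph (suc n)) (a b : Fin (suc n)) → adj G a b ≡ true →
       q (suc n) G ≈ₚ (q n (G ─ a) +ₚ q n (pivot G a b ─ b)))

-- G is the union of two complete graphs sharing some but not all vertices:
-- V = V₁ ∪ V₂ ∪ V₃ (classes 0,1,2 of c), all nonempty and pairwise disjoint,
-- V₁ ∪ V₂ and V₂ ∪ V₃ complete, no edges between V₁ and V₃.

open import Data.Fin using (zero; suc)

TwoCliques : ∀ {n} → Graph n → Set
TwoCliques {n} G = Σ (Fin n → Fin 3) λ c →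
    (∀ k → ∃ λ i → c i ≡ k)
  × (∀ i j → ¬ i ≡ j → ¬ c i ≡ suc (suc zero) → ¬ c j ≡ suc (suc zero) → adj G i j ≡ true)
  × (∀ i j → ¬ i ≡ j → ¬ c i ≡ zero → ¬ c j ≡ zero → adj G i j ≡ true)
  × (∀ i j → c i ≡ zero → c j ≡ suc (suc zero) → adj G i j ≡ false)

-- Write q₁ G for q(G;1). The recursion on an edge ab gives q₁ G = q₁ (G − a) + q₁ (G^{ab} − b),
-- and if the adjacency of G is read off a colouring of its vertices, then so is that of G − a
-- and of G^{ab} − b. This evaluates q₁ to 2^{n−1} on complete graphs, to 2^{n−2} on two disjoint
-- cliques, and to 3·2^{n−3} on two cliques sharing some but not all vertices: pivoting on
-- a ∈ V₁, b ∈ V₂ yields two such cliques again, or two disjoint cliques when V₁ = {a}.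
-- Every other graph has q₁ < 3·2^{n−3}, by induction on n. If G has a universal vertex u, pivot
-- on an edge ub: G is complete or two overlapping cliques as soon as G − u is, or as soon as
-- G^{ub} − b is complete. Otherwise pivot on any edge ab: G − a is not complete (b would be
-- universal), nor is G^{ab} − b (a would be), and they are not both overlapping cliques, since
-- G has a universal vertex once both of them have one.
module Submission where

open import Data.Bool using (Bool; true; false; not; _∧_; _∨_; _xor_; if_then_else_)
open import Data.Bool.Properties
  using (¬-not; not-¬; not-injective; not-involutive; xor-comm; xor-identityʳ)
  renaming (_≟_ to _≟ᵇ_)
open import Data.Empty using (⊥-elim)
open import Data.Fin using (Fin; zero; suc; punchIn; punchOut; _≟_)
open import Data.Fin.Properties
  using (punchIn-injective; punchInᵢ≢i; punchIn-punchOut; any?; all?; pigeonhole)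
  renaming (<⇒≢ to <⇒≢ᶠ)
open import Data.Integer as ℤ using (ℤ; +_; _<_; 0ℤ; 1ℤ; _+_)
import Data.Integer.Properties as ℤₚ
open import Algebra.Properties.CommutativeSemigroup ℤₚ.+-commutativeSemigroup
  using (interchange)
open import Data.List using ([]; _∷_)
open import Data.Nat as ℕ using (ℕ; zero; suc; _≤_; _*_; _^_; _∸_; s≤s; z≤n)
import Data.Nat.Properties as ℕₚ
open import Data.Nat.Tactic.RingSolver using (solve-∀)
open import Data.Product using (_×_; ∃; ∃₂; _,_; proj₁; proj₂)
open import Data.Sum using (_⊎_; inj₁; inj₂; map₂)
open import Data.Unit using (tt)
open import Data.Vec.Functional using (insertAt)
open import Data.Vec.Functional.Properties using (insertAt-lookup; insertAt-punchIn)
open import Function using (_∘_)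
open import Function.Bundles using (_⇔_; mk⇔)
open import Relation.Binary.PropositionalEquality
open import Relation.Nullary using (¬_; Dec; yes; no)
open import Relation.Nullary.Decidable using (⌊_⌋; ¬?; _×-dec_; _→-dec_)

open import Defs hiding (sym)

-- Graphs patterned by a colouring

-- The parts V₁, V₂, V₃ of TwoCliques, V₂ being the shared one.
pattern left   = zero
pattern shared = suc zero
pattern right  = suc (suc zero)

disjointCliques : Bool → Bool → Bool
disjointCliques p r = not (p xor r)

overlappingCliques : Fin 3 → Fin 3 → Bool
overlappingCliques left  right = false
overlappingCliques right left  = false
overlappingCliques _     _     = true

disjointCliques-sym : ∀ p r → disjointCliques p r ≡ disjointCliques r p
disjointCliques-sym p r = cong not (xor-comm p r)

disjointCliques-refl : ∀ p → disjointCliques p p ≡ true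
disjointCliques-refl false = refl
disjointCliques-refl true  = refl

disjointCliques-same : ∀ {p r} → disjointCliques p r ≡ true → p ≡ r
disjointCliques-same {false} {false} _ = refl
disjointCliques-same {true}  {true}  _ = refl

overlappingCliques-sym : ∀ k l → overlappingCliques k l ≡ overlappingCliques l k
overlappingCliques-sym left   left   = refl
overlappingCliques-sym left   shared = refl
overlappingCliques-sym left   right  = refl
overlappingCliques-sym shared left   = refl
overlappingCliques-sym shared shared = refl
overlappingCliques-sym shared right  = refl
overlappingCliques-sym right  left   = refl
overlappingCliques-sym right  shared = refl
overlappingCliques-sym right  right  = refl

overlappingCliques-≢left : ∀ k l → k ≢ left → l ≢ left → overlappingCliques k l ≡ true
overlappingCliques-≢left left   _      k≢ _  = ⊥-elim (k≢ refl)
overlappingCliques-≢left shared _      _  _  = refl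
overlappingCliques-≢left right  left   _  l≢ = ⊥-elim (l≢ refl)
overlappingCliques-≢left right  shared _  _  = refl
overlappingCliques-≢left right  right  _  _  = refl

overlappingCliques-≢right : ∀ k l → k ≢ right → l ≢ right → overlappingCliques k l ≡ true
overlappingCliques-≢right right  _      k≢ _  = ⊥-elim (k≢ refl)
overlappingCliques-≢right shared _      _  _  = refl
overlappingCliques-≢right left   right  _  l≢ = ⊥-elim (l≢ refl)
overlappingCliques-≢right left   left   _  _  = refl
overlappingCliques-≢right left   shared _  _  = refl

Patterned : ∀ {n} {K : Set} → Graph n → (Fin n → K) → (K → K → Bool) → Set
Patterned G c f = ∀ i j → i ≢ j → adj G i j ≡ f (c i) (c j)

PatternedOff : ∀ {n} {K : Set} → Fin n → Graph n → (Fin n → K) → (K → K → Bool) → Set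
PatternedOff a G c f = ∀ x y → x ≢ a → y ≢ a → x ≢ y → adj G x y ≡ f (c x) (c y)

Complete : ∀ {n} → Graph n → Set
Complete G = Patterned G (λ _ → tt) (λ _ _ → true)

Onto : ∀ {n} {K : Set} → (Fin n → K) → Set
Onto c = ∀ k → ∃ λ i → c i ≡ k

Universal : ∀ {n} → Graph n → Fin n → Set
Universal G u = ∀ x → x ≢ u → adj G u x ≡ true

≡-≢-trans : ∀ {A : Set} {x y z : A} → x ≡ y → y ≢ z → x ≢ z
≡-≢-trans refl y≢z = y≢z

colour-≢ : ∀ {n} {K : Set} (c : Fin n → K) {i j k l} → c i ≡ k → c j ≡ l → k ≢ l → i ≢ j
colour-≢ c ci cj k≢l refl = k≢l (trans (sym ci) cj)

adj⇒≢ : ∀ {n} (G : Graph n) {x y} → adj G x y ≡ true → x ≢ y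
adj⇒≢ G {x} xy refl with () ← trans (sym xy) (irrefl G x)

toTwoCliques : ∀ {n} (G : Graph n) (c : Fin n → Fin 3) → Onto c →
  Patterned G c overlappingCliques → TwoCliques G
toTwoCliques G c onto P = c , onto
  , (λ i j i≢j ci cj → trans (P i j i≢j) (overlappingCliques-≢right _ _ ci cj))
  , (λ i j i≢j ci cj → trans (P i j i≢j) (overlappingCliques-≢left _ _ ci cj))
  , (λ i j ci cj → trans (P i j (colour-≢ c ci cj λ ())) (cong₂ overlappingCliques ci cj))

twoCliques-patterned : ∀ {n} (G : Graph n) (T : TwoCliques G) →
  Patterned G (proj₁ T) overlappingCliques
twoCliques-patterned G (c , _ , V₁₂ , V₂₃ , V₁₃) i j i≢j with c i in ci | c j in cj
... | left   | left   = V₁₂ i j i≢j (≡-≢-trans ci λ ()) (≡-≢-trans cj λ ())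
... | left   | shared = V₁₂ i j i≢j (≡-≢-trans ci λ ()) (≡-≢-trans cj λ ())
... | left   | right  = V₁₃ i j ci cj
... | shared | left   = V₁₂ i j i≢j (≡-≢-trans ci λ ()) (≡-≢-trans cj λ ())
... | shared | shared = V₁₂ i j i≢j (≡-≢-trans ci λ ()) (≡-≢-trans cj λ ())
... | shared | right  = V₂₃ i j i≢j (≡-≢-trans ci λ ()) (≡-≢-trans cj λ ())
... | right  | left   = trans (Graph.sym G i j) (V₁₃ j i cj ci)
... | right  | shared = V₂₃ i j i≢j (≡-≢-trans ci λ ()) (≡-≢-trans cj λ ())
... | right  | right  = V₂₃ i j i≢j (≡-≢-trans ci λ ()) (≡-≢-trans cj λ ())

Patterned-≢left⇒complete : ∀ {n} (G : Graph n) {c : Fin n → Fin 3} →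
  Patterned G c overlappingCliques → (∀ x → c x ≢ left) → Complete G
Patterned-≢left⇒complete G P ≢left i j i≢j =
  trans (P i j i≢j) (overlappingCliques-≢left _ _ (≢left i) (≢left j))

completeOrTwoCliques : ∀ {n} (G : Graph n) (c : Fin n → Fin 3) →
  Patterned G c overlappingCliques → (∃ λ x → c x ≡ shared) → (∃ λ x → c x ≡ right) →
  Complete G ⊎ TwoCliques G
completeOrTwoCliques G c P s r with any? (λ x → c x ≟ left)
... | yes l = inj₂ (toTwoCliques G c (λ { left → l ; shared → s ; right → r }) P)
... | no ¬l = inj₁ (Patterned-≢left⇒complete G {c} P λ x cx → ¬l (x , cx))

Patterned-recolour : ∀ {n} {K L : Set} (G : Graph n) (c : Fin n → K) f (σ : K → L) f′ →
  (∀ k l → f k l ≡ f′ (σ k) (σ l)) → Patterned G c f → Patterned G (σ ∘ c) f′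
Patterned-recolour G c f σ f′ σ-resp P i j i≢j = trans (P i j i≢j) (σ-resp _ _)

isYes-≟-sym : ∀ {n} (i j : Fin n) → ⌊ i ≟ j ⌋ ≡ ⌊ j ≟ i ⌋
isYes-≟-sym i j with i ≟ j | j ≟ i
... | yes _   | yes _   = refl
... | no _    | no _    = refl
... | yes i≡j | no j≢i  = ⊥-elim (j≢i (sym i≡j))
... | no i≢j  | yes j≡i = ⊥-elim (i≢j (sym j≡i))

patternGraph : ∀ {n} {K : Set} (c : Fin n → K) (f : K → K → Bool) →
  (∀ k l → f k l ≡ f l k) → Graph n
adj       (patternGraph c f f-sym) i j = not ⌊ i ≟ j ⌋ ∧ f (c i) (c j)
Graph.sym (patternGraph c f f-sym) i j =
  cong₂ _∧_ (cong not (isYes-≟-sym i j)) (f-sym _ _)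
irrefl    (patternGraph c f f-sym) i with i ≟ i
... | yes _  = refl
... | no i≢i = ⊥-elim (i≢i refl)

patternGraph-patterned : ∀ {n} {K : Set} (c : Fin n → K) f (f-sym : ∀ k l → f k l ≡ f l k) →
  Patterned (patternGraph c f f-sym) c f
patternGraph-patterned c f f-sym i j i≢j with i ≟ j
... | yes i≡j = ⊥-elim (i≢j i≡j)
... | no _    = refl

-- Deleting and inserting a vertex

data PunchInView {n} (a : Fin (suc n)) : Fin (suc n) → Set where
  at    : PunchInView a a
  other : ∀ i → PunchInView a (punchIn a i)

punchInView : ∀ {n} (a x : Fin (suc n)) → PunchInView a x
punchInView a x with a ≟ x
... | yes refl = at
... | no a≢x   = subst (PunchInView a) (punchIn-punchOut a≢x) (other (punchOut a≢x))

Onto-─ : ∀ {n} {K : Set} (c : Fin (suc n) → K) a →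
  (∀ k → ∃ λ x → c x ≡ k × x ≢ a) → Onto (c ∘ punchIn a)
Onto-─ c a witness k with witness k
... | x , cx , x≢a with punchInView a x
...   | at      = ⊥-elim (x≢a refl)
...   | other i = i , cx

Onto-─-twin : ∀ {n} {K : Set} (c : Fin (suc n) → K) {a b} → a ≢ b → c a ≡ c b →
  Onto c → Onto (c ∘ punchIn a)
Onto-─-twin c {a} {b} a≢b same onto = Onto-─ c a witness
  where
  witness : ∀ k → ∃ λ x → c x ≡ k × x ≢ a
  witness k with onto k
  ... | x , cx with x ≟ a
  ...   | yes refl = b , trans (sym same) cx , a≢b ∘ sym
  ...   | no x≢a   = x , cx , x≢a

PatternedOff-─ : ∀ {n} {K : Set} (G : Graph (suc n)) (c : Fin (suc n) → K) f a →
  PatternedOff a G c f → Patterned (G ─ a) (c ∘ punchIn a) f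
PatternedOff-─ G c f a P i j i≢j =
  P _ _ (punchInᵢ≢i a i) (punchInᵢ≢i a j) (i≢j ∘ punchIn-injective a i j)

Patterned-─ : ∀ {n} {K : Set} (G : Graph (suc n)) (c : Fin (suc n) → K) f a →
  Patterned G c f → Patterned (G ─ a) (c ∘ punchIn a) f
Patterned-─ G c f a P = PatternedOff-─ G c f a λ x y _ _ → P x y

Complete-─⁻ : ∀ {n} (G : Graph (suc n)) a → Complete (G ─ a) →
  PatternedOff a G (λ _ → tt) (λ _ _ → true)
Complete-─⁻ G a C x y x≢a y≢a x≢y with punchInView a x | punchInView a y
... | at      | _       = ⊥-elim (x≢a refl)
... | other _ | at      = ⊥-elim (y≢a refl)
... | other i | other j = C i j (x≢y ∘ cong (punchIn a))

Universal-─⁻ : ∀ {n} (G : Graph (suc n)) a {w} → Universal (G ─ a) w →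
  ∀ x → x ≢ a → x ≢ punchIn a w → adj G (punchIn a w) x ≡ true
Universal-─⁻ G a U x x≢a x≢w with punchInView a x
... | at      = ⊥-elim (x≢a refl)
... | other i = U i (x≢w ∘ cong (punchIn a))

Patterned-insertAt : ∀ {n} {K : Set} (G : Graph (suc n)) u (c : Fin n → K) f k →
  (∀ k l → f k l ≡ f l k) → (∀ i → adj G u (punchIn u i) ≡ f k (c i)) →
  Patterned (G ─ u) c f → Patterned G (insertAt c u k) f
Patterned-insertAt G u c f k f-sym row P x y = patterned (punchInView u x) (punchInView u y)
  where
  c⁺ = insertAt c u k
  row⁺ : ∀ j → adj G u (punchIn u j) ≡ f (c⁺ u) (c⁺ (punchIn u j))
  row⁺ j = trans (row j) (sym (cong₂ f (insertAt-lookup c u k) (insertAt-punchIn c u k j)))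
  patterned : ∀ {x y} → PunchInView u x → PunchInView u y → x ≢ y → adj G x y ≡ f (c⁺ x) (c⁺ y)
  patterned at        at        x≢y = ⊥-elim (x≢y refl)
  patterned at        (other j) _   = row⁺ j
  patterned (other i) at        _   = trans (Graph.sym G _ u) (trans (row⁺ i) (f-sym _ _))
  patterned (other i) (other j) x≢y = trans (P i j (x≢y ∘ cong (punchIn u)))
    (sym (cong₂ f (insertAt-punchIn c u k i) (insertAt-punchIn c u k j)))

universal-row : ∀ {n} (G : Graph (suc n)) {u} → Universal G u →
  ∀ i → adj G u (punchIn u i) ≡ true
universal-row G {u} U i = U _ (punchInᵢ≢i u i)

complete-insertUniversal : ∀ {n} (G : Graph (suc n)) u → Universal G u →
  Complete (G ─ u) → Complete G
complete-insertUniversal G u U =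
  Patterned-insertAt G u (λ _ → tt) (λ _ _ → true) tt (λ _ _ → refl) (universal-row G U)

twoCliques-insertUniversal : ∀ {n} (G : Graph (suc n)) u → Universal G u →
  TwoCliques (G ─ u) → TwoCliques G
twoCliques-insertUniversal G u U T@(c , onto , _) = toTwoCliques G (insertAt c u shared) onto⁺
  (Patterned-insertAt G u c overlappingCliques shared overlappingCliques-sym (universal-row G U)
    (twoCliques-patterned (G ─ u) T))
  where
  onto⁺ : Onto (insertAt c u shared)
  onto⁺ k = let i , ci = onto k in punchIn u i , trans (insertAt-punchIn c u shared i) ci

side : Bool → Fin 3
side true  = right
side false = left

disjointCliques-side : ∀ p r → disjointCliques p r ≡ overlappingCliques (side p) (side r)
disjointCliques-side false false = refl
disjointCliques-side false true  = refl
disjointCliques-side true  false = refl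
disjointCliques-side true  true  = refl

disjointCliques-insertUniversal : ∀ {n} (G : Graph (suc n)) u d → Universal G u →
  Patterned (G ─ u) d disjointCliques → (∃ λ i → d i ≡ true) → Complete G ⊎ TwoCliques G
disjointCliques-insertUniversal G u d U P (i , di) =
  completeOrTwoCliques G (insertAt (side ∘ d) u shared)
    (Patterned-insertAt G u (side ∘ d) overlappingCliques shared overlappingCliques-sym
      (universal-row G U)
      (Patterned-recolour (G ─ u) d disjointCliques side overlappingCliques disjointCliques-side P))
    (u , insertAt-lookup _ u shared)
    (punchIn u i , trans (insertAt-punchIn _ u shared i) (cong side di))

-- Pivoting

pivot-away : ∀ {n} (G : Graph n) {a b x y} → x ≢ a → x ≢ b → y ≢ a → y ≢ b →
  adj (pivot G a b) x y
    ≡ adj G x y xor toggleCls (adj G a x) (adj G b x) (adj G a y) (adj G b y)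
pivot-away G {a} {b} {x} {y} x≢a x≢b y≢a y≢b with x ≟ a | x ≟ b | y ≟ a | y ≟ b
... | yes x≡a | _       | _       | _       = ⊥-elim (x≢a x≡a)
... | no _    | yes x≡b | _       | _       = ⊥-elim (x≢b x≡b)
... | no _    | no _    | yes y≡a | _       = ⊥-elim (y≢a y≡a)
... | no _    | no _    | no _    | yes y≡b = ⊥-elim (y≢b y≡b)
... | no _    | no _    | no _    | no _    = refl

pivot-row : ∀ {n} (G : Graph n) a b y → adj (pivot G a b) a y ≡ adj G a y
pivot-row G a b y with a ≟ a
... | yes _   = xor-identityʳ _
... | no a≢a  = ⊥-elim (a≢a refl)

toggleCls-twins : ∀ p r → toggleCls p p r r ≡ false
toggleCls-twins false false = refl
toggleCls-twins false true  = refl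
toggleCls-twins true  false = refl
toggleCls-twins true  true  = refl

pivotedPattern : {K : Set} → (K → K → Bool) → K → K → K → K → Bool
pivotedPattern f ka kb k l = f k l xor toggleCls (f ka k) (f kb k) (f ka l) (f kb l)

pivotedPattern-twins : ∀ {K : Set} (f : K → K → Bool) k l m →
  pivotedPattern f k k l m ≡ f l m
pivotedPattern-twins f k l m rewrite toggleCls-twins (f k l) (f k m) = xor-identityʳ _

Patterned-pivot-─ : ∀ {n} {K L : Set} (G : Graph (suc n)) a b (c : Fin (suc n) → K) f
  (c′ : Fin (suc n) → L) f′ → (∀ k l → f′ k l ≡ f′ l k) → Patterned G c f →
  (∀ y → y ≢ a → y ≢ b → f (c a) (c y) ≡ f′ (c′ a) (c′ y)) →
  (∀ x y → x ≢ a → x ≢ b → y ≢ a → y ≢ b →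
     pivotedPattern f (c a) (c b) (c x) (c y) ≡ f′ (c′ x) (c′ y)) →
  Patterned (pivot G a b ─ b) (c′ ∘ punchIn b) f′
Patterned-pivot-─ G a b c f c′ f′ f′-sym P row away = PatternedOff-─ H c′ f′ b patterned
  where
  H = pivot G a b
  fromA : ∀ y → y ≢ a → y ≢ b → adj H a y ≡ f′ (c′ a) (c′ y)
  fromA y y≢a y≢b = trans (pivot-row G a b y) (trans (P a y (y≢a ∘ sym)) (row y y≢a y≢b))
  patterned : PatternedOff b H c′ f′
  patterned x y x≢b y≢b x≢y = byCases (x ≟ a) (y ≟ a)
    where
    byCases : Dec (x ≡ a) → Dec (y ≡ a) → adj H x y ≡ f′ (c′ x) (c′ y)
    byCases (yes refl) _          = fromA y (x≢y ∘ sym) y≢b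
    byCases (no x≢a)   (yes refl) =
      trans (Graph.sym H x a) (trans (fromA x x≢a x≢b) (f′-sym _ _))
    byCases (no x≢a)   (no y≢a)
      rewrite pivot-away G x≢a x≢b y≢a y≢b | P x y x≢y
            | P a x (x≢a ∘ sym) | P b x (x≢b ∘ sym) | P a y (y≢a ∘ sym) | P b y (y≢b ∘ sym)
      = away x y x≢a x≢b y≢a y≢b

complete-pivot-─ : ∀ {n} (G : Graph (suc n)) a b → Complete G → Complete (pivot G a b ─ b)
complete-pivot-─ G a b C =
  Patterned-pivot-─ G a b (λ _ → tt) (λ _ _ → true) (λ _ → tt) (λ _ _ → true) (λ _ _ → refl) C
    (λ _ _ _ → refl) (λ _ _ _ _ _ _ → refl)

disjointCliques-pivot-─ : ∀ {n} (G : Graph (suc n)) {d a b} → Patterned G d disjointCliques →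
  d a ≡ d b → Patterned (pivot G a b ─ b) (d ∘ punchIn b) disjointCliques
disjointCliques-pivot-─ G {d} {a} {b} P da≡db =
  Patterned-pivot-─ G a b d disjointCliques d disjointCliques disjointCliques-sym P
    (λ _ _ _ → refl) away
  where
  away : ∀ x y → x ≢ a → x ≢ b → y ≢ a → y ≢ b →
    pivotedPattern disjointCliques (d a) (d b) (d x) (d y) ≡ disjointCliques (d x) (d y)
  away x y _ _ _ _ rewrite da≡db = pivotedPattern-twins disjointCliques (d b) (d x) (d y)

inRight : Fin 3 → Bool
inRight right = true
inRight _     = false

overlappingCliques-left-row : ∀ l → overlappingCliques left l ≡ disjointCliques false (inRight l)
overlappingCliques-left-row left   = refl
overlappingCliques-left-row shared = refl
overlappingCliques-left-row right  = refl

pivotedPattern-lone-left : ∀ k l → k ≢ left → l ≢ left →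
  pivotedPattern overlappingCliques left shared k l ≡ disjointCliques (inRight k) (inRight l)
pivotedPattern-lone-left left   _      k≢ _  = ⊥-elim (k≢ refl)
pivotedPattern-lone-left shared left   _  l≢ = ⊥-elim (l≢ refl)
pivotedPattern-lone-left right  left   _  l≢ = ⊥-elim (l≢ refl)
pivotedPattern-lone-left shared shared _  _  = refl
pivotedPattern-lone-left shared right  _  _  = refl
pivotedPattern-lone-left right  shared _  _  = refl
pivotedPattern-lone-left right  right  _  _  = refl

twins-adjacent : ∀ {n} (G : Graph n) d {a b} → Patterned G d disjointCliques →
  a ≢ b → d a ≡ d b → adj G a b ≡ true
twins-adjacent G d {a} P a≢b da≡db =
  trans (P _ _ a≢b) (trans (cong (disjointCliques (d a)) (sym da≡db)) (disjointCliques-refl (d a)))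

left-shared-adjacent : ∀ {n} (G : Graph n) c {a b} → Patterned G c overlappingCliques →
  c a ≡ left → c b ≡ shared → adj G a b ≡ true
left-shared-adjacent G c P ca cb =
  trans (P _ _ (colour-≢ c ca cb λ ())) (cong₂ overlappingCliques ca cb)

lone-left-─ : ∀ {n} (G : Graph (suc n)) c {a} → Patterned G c overlappingCliques →
  (∀ x → c x ≡ left → x ≡ a) → Complete (G ─ a)
lone-left-─ G c {a} P lone = Patterned-≢left⇒complete (G ─ a)
  (Patterned-─ G c overlappingCliques a P) λ i ci → punchInᵢ≢i a i (lone _ ci)

lone-left-pivot-─ : ∀ {n} (G : Graph (suc n)) c {a b} → Onto c →
  Patterned G c overlappingCliques → c a ≡ left → c b ≡ shared → (∀ x → c x ≡ left → x ≡ a) →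
  Onto (inRight ∘ c ∘ punchIn b) ×
  Patterned (pivot G a b ─ b) (inRight ∘ c ∘ punchIn b) disjointCliques
lone-left-pivot-─ G c {a} {b} onto P ca cb lone =
  Onto-─ (inRight ∘ c) b witness ,
  Patterned-pivot-─ G a b c overlappingCliques (inRight ∘ c) disjointCliques
    disjointCliques-sym P row away
  where
  witness : ∀ p → ∃ λ x → inRight (c x) ≡ p × x ≢ b
  witness true  = let w , cw = onto right in w , cong inRight cw , colour-≢ c cw cb λ ()
  witness false = a , cong inRight ca , colour-≢ c ca cb λ ()
  row : ∀ y → y ≢ a → y ≢ b →
    overlappingCliques (c a) (c y) ≡ disjointCliques (inRight (c a)) (inRight (c y))
  row y _ _ rewrite ca = overlappingCliques-left-row (c y)
  away : ∀ x y → x ≢ a → x ≢ b → y ≢ a → y ≢ b →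
    pivotedPattern overlappingCliques (c a) (c b) (c x) (c y)
      ≡ disjointCliques (inRight (c x)) (inRight (c y))
  away x y x≢a _ y≢a _ rewrite ca | cb =
    pivotedPattern-lone-left (c x) (c y) (x≢a ∘ lone x) (y≢a ∘ lone y)

swap₀₁ : Fin 3 → Fin 3
swap₀₁ left   = shared
swap₀₁ shared = left
swap₀₁ right  = right

-- Pivoting on a ∈ V₁, b ∈ V₂ swaps the roles of V₁ and V₂, except that a stays outside the
-- shared part.
pivotColours : ∀ {n} → (Fin n → Fin 3) → Fin n → Fin n → Fin 3
pivotColours c a x = if ⌊ x ≟ a ⌋ then left else swap₀₁ (c x)

pivotColours-self : ∀ {n} (c : Fin n → Fin 3) a → pivotColours c a a ≡ left
pivotColours-self c a with a ≟ a
... | yes _  = refl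
... | no a≢a = ⊥-elim (a≢a refl)

pivotColours-other : ∀ {n} (c : Fin n → Fin 3) {a x} → x ≢ a →
  pivotColours c a x ≡ swap₀₁ (c x)
pivotColours-other c {a} {x} x≢a with x ≟ a
... | yes x≡a = ⊥-elim (x≢a x≡a)
... | no _    = refl

overlappingCliques-left-swap : ∀ l →
  overlappingCliques left l ≡ overlappingCliques left (swap₀₁ l)
overlappingCliques-left-swap left   = refl
overlappingCliques-left-swap shared = refl
overlappingCliques-left-swap right  = refl

pivotedPattern-swap : ∀ k l →
  pivotedPattern overlappingCliques left shared k l ≡ overlappingCliques (swap₀₁ k) (swap₀₁ l)
pivotedPattern-swap left   left   = refl
pivotedPattern-swap left   shared = refl
pivotedPattern-swap left   right  = refl
pivotedPattern-swap shared left   = refl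
pivotedPattern-swap shared shared = refl
pivotedPattern-swap shared right  = refl
pivotedPattern-swap right  left   = refl
pivotedPattern-swap right  shared = refl
pivotedPattern-swap right  right  = refl

twin-left-pivot-─ : ∀ {n} (G : Graph (suc n)) c {a a′ b} → Onto c →
  Patterned G c overlappingCliques → c a ≡ left → c a′ ≡ left → a′ ≢ a → c b ≡ shared →
  Onto (pivotColours c a ∘ punchIn b) ×
  Patterned (pivot G a b ─ b) (pivotColours c a ∘ punchIn b) overlappingCliques
twin-left-pivot-─ G c {a} {a′} {b} onto P ca ca′ a′≢a cb =
  Onto-─ (pivotColours c a) b witness ,
  Patterned-pivot-─ G a b c overlappingCliques (pivotColours c a) overlappingCliques
    overlappingCliques-sym P row away
  where
  witness : ∀ k → ∃ λ x → pivotColours c a x ≡ k × x ≢ b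
  witness left   = a , pivotColours-self c a , colour-≢ c ca cb λ ()
  witness shared =
    a′ , trans (pivotColours-other c a′≢a) (cong swap₀₁ ca′) , colour-≢ c ca′ cb λ ()
  witness right  = let w , cw = onto right in
    w , trans (pivotColours-other c (colour-≢ c cw ca λ ())) (cong swap₀₁ cw) ,
    colour-≢ c cw cb λ ()
  row : ∀ y → y ≢ a → y ≢ b →
    overlappingCliques (c a) (c y) ≡ overlappingCliques (pivotColours c a a) (pivotColours c a y)
  row y y≢a _ = begin
    overlappingCliques (c a) (c y)          ≡⟨ cong (λ k → overlappingCliques k (c y)) ca ⟩
    overlappingCliques left (c y)           ≡⟨ overlappingCliques-left-swap (c y) ⟩
    overlappingCliques left (swap₀₁ (c y))
      ≡⟨ cong₂ overlappingCliques (pivotColours-self c a) (pivotColours-other c y≢a) ⟨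
    overlappingCliques (pivotColours c a a) (pivotColours c a y) ∎
    where open ≡-Reasoning
  away : ∀ x y → x ≢ a → x ≢ b → y ≢ a → y ≢ b →
    pivotedPattern overlappingCliques (c a) (c b) (c x) (c y)
      ≡ overlappingCliques (pivotColours c a x) (pivotColours c a y)
  away x y x≢a _ y≢a _ rewrite ca | cb | pivotColours-other c x≢a | pivotColours-other c y≢a =
    pivotedPattern-swap (c x) (c y)

-- Universal vertices

twoCliques⇒universal : ∀ {n} (G : Graph n) → TwoCliques G → ∃ (Universal G)
twoCliques⇒universal G T@(c , onto , _) = let v , cv = onto shared in
  v , λ x x≢v → trans (twoCliques-patterned G T v x (x≢v ∘ sym))
                      (cong (λ k → overlappingCliques k (c x)) cv)

closedNbhd : ∀ {n} → Graph n → Fin n → Fin n → Bool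
closedNbhd G b x = ⌊ x ≟ b ⌋ ∨ adj G b x

closedNbhd-self : ∀ {n} (G : Graph n) b → closedNbhd G b b ≡ true
closedNbhd-self G b with b ≟ b
... | yes _   = refl
... | no b≢b  = ⊥-elim (b≢b refl)

-- When a is universal, every other vertex lies in class (1) or (3) of the pivot on ab,
-- and exactly the pairs split by adjacency to b are toggled.
xor-toggleCls-universal : ∀ g p r → g xor toggleCls true p true r ≡ true → g ≡ disjointCliques p r
xor-toggleCls-universal false false true  _ = refl
xor-toggleCls-universal false true  false _ = refl
xor-toggleCls-universal true  false false _ = refl
xor-toggleCls-universal true  true  true  _ = refl

universal-pivot-complete : ∀ {n} (G : Graph (suc n)) u b → Universal G u → b ≢ u →
  Complete (pivot G u b ─ b) → Complete G ⊎ TwoCliques G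
universal-pivot-complete G u b U b≢u C =
  disjointCliques-insertUniversal G u (closedNbhd G b ∘ punchIn u) U
  (PatternedOff-─ G (closedNbhd G b) disjointCliques u twoSides)
  (punchOut u≢b , trans (cong (closedNbhd G b) (punchIn-punchOut u≢b)) (closedNbhd-self G b))
  where
  u≢b = b≢u ∘ sym
  twoSides : PatternedOff u G (closedNbhd G b) disjointCliques
  twoSides x y x≢u y≢u x≢y with x ≟ b | y ≟ b
  ... | yes refl | yes refl = ⊥-elim (x≢y refl)
  ... | yes refl | no _     = sym (not-involutive _)
  ... | no _     | yes refl =
    trans (Graph.sym G x b) (trans (sym (not-involutive _)) (disjointCliques-sym true _))
  ... | no x≢b   | no y≢b   = xor-toggleCls-universal _ _ _ (begin
    adj G x y xor toggleCls true (adj G b x) true (adj G b y)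
      ≡⟨ cong₂ (λ p r → adj G x y xor toggleCls p (adj G b x) r (adj G b y))
               (U x x≢u) (U y y≢u) ⟨
    adj G x y xor toggleCls (adj G u x) (adj G b x) (adj G u y) (adj G b y)
      ≡⟨ pivot-away G x≢u x≢b y≢u y≢b ⟨
    adj (pivot G u b) x y
      ≡⟨ Complete-─⁻ (pivot G u b) b C x y x≢b y≢b x≢y ⟩
    true ∎)
    where open ≡-Reasoning

universal-except : ∀ {n} (G : Graph n) {v y} → (∀ x → x ≢ v → x ≢ y → adj G v x ≡ true) →
  adj G v y ≡ true → Universal G v
universal-except G {y = y} U vy x x≢v with x ≟ y
... | yes refl = vy
... | no x≢y   = U x x≢v x≢y

Universal-pivot : ∀ {n} (G : Graph n) a b → Universal (pivot G a b) a → Universal G a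
Universal-pivot G a b U x x≢a = trans (sym (pivot-row G a b x)) (U x x≢a)

complete-─⇒universal : ∀ {n} (G : Graph (suc n)) a b → Complete (G ─ a) →
  adj G b a ≡ true → Universal G b
complete-─⇒universal G a b C ba =
  universal-except G (λ x x≢b x≢a → Complete-─⁻ G a C b x (adj⇒≢ G ba) x≢a (x≢b ∘ sym)) ba

complete-pivot-─⇒universal : ∀ {n} (G : Graph (suc n)) a b → Complete (pivot G a b ─ b) →
  adj G a b ≡ true → Universal G a
complete-pivot-─⇒universal G a b C ab = Universal-pivot G a b
  (complete-─⇒universal (pivot G a b) b a C (trans (pivot-row G a b b) ab))

xor-toggleCls-class₂ : ∀ p → true xor toggleCls true p false true ≡ false
xor-toggleCls-class₂ false = refl
xor-toggleCls-class₂ true  = refl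

universal-─-pivot : ∀ {n} (G : Graph (suc n)) a b → adj G a b ≡ true →
  ∃ (Universal (G ─ a)) → ∃ (Universal (pivot G a b ─ b)) → ∃ (Universal G)
universal-─-pivot G a b ab (w , Uw) (u , Uu) = byCases (adj G W a ≟ᵇ true) (U ≟ a)
  where
  W = punchIn a w
  U = punchIn b u
  H = pivot G a b
  a≢b = adj⇒≢ G ab
  byCases : Dec (adj G W a ≡ true) → Dec (U ≡ a) → ∃ (Universal G)
  byCases (yes Wa) _ =
    W , universal-except G (λ x x≢W x≢a → Universal-─⁻ G a Uw x x≢a x≢W) Wa
  byCases (no _) (yes U≡a) = a , Universal-pivot G a b (universal-except H
    (λ x x≢a x≢b → subst (λ v → adj H v x ≡ true) U≡a
                     (Universal-─⁻ H b Uu x x≢b (x≢a ∘ λ x≡U → trans x≡U U≡a)))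
    (trans (pivot-row G a b b) ab))
  byCases (no ¬Wa) (no U≢a) =
    ⊥-elim (not-¬ (Universal-─⁻ H b Uu W W≢b (U≢W ∘ sym)) toggled)
    where
    Wa : adj G W a ≡ false
    Wa = ¬-not ¬Wa
    W≢b : W ≢ b
    W≢b W≡b with () ←
      trans (sym Wa) (trans (cong (λ v → adj G v a) W≡b) (trans (Graph.sym G b a) ab))
    aU : adj G a U ≡ true
    aU = trans (sym (pivot-row G a b U))
           (trans (Graph.sym H a U) (Universal-─⁻ H b Uu a a≢b (U≢a ∘ sym)))
    U≢W : U ≢ W
    U≢W U≡W with () ←
      trans (sym aU) (trans (cong (adj G a) U≡W) (trans (Graph.sym G a W) Wa))
    -- W is in class (2) of the pivot on ab and U in class (1) or (3): the pivot removes UW.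
    toggled : adj H U W ≡ false
    toggled
      rewrite pivot-away G U≢a (punchInᵢ≢i b u) (punchInᵢ≢i a w) W≢b
            | trans (Graph.sym G U W) (Universal-─⁻ G a Uw U U≢a U≢W) | aU
            | trans (Graph.sym G a W) Wa
            | trans (Graph.sym G b W) (Universal-─⁻ G a Uw b (a≢b ∘ sym) (W≢b ∘ sym))
      = xor-toggleCls-class₂ (adj G b U)

universal? : ∀ {n} (G : Graph n) → Dec (∃ (Universal G))
universal? G = any? λ u → all? λ x → ¬? (x ≟ u) →-dec adj G u x ≟ᵇ true

edge? : ∀ {n} (G : Graph n) → Dec (∃₂ λ a b → adj G a b ≡ true)
edge? G = any? λ a → any? λ b → adj G a b ≟ᵇ true

another : ∀ {n} (u : Fin (suc (suc n))) → ∃ λ b → b ≢ u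
another zero    = suc zero , λ ()
another (suc u) = zero , λ ()

two-vertices : (G : Graph 2) → Complete G ⊎ Edgeless G
two-vertices G with adj G zero (suc zero) in e
... | true  = inj₁ λ where
  zero       zero       0≢0 → ⊥-elim (0≢0 refl)
  zero       (suc zero) _   → e
  (suc zero) zero       _   → trans (Graph.sym G _ _) e
  (suc zero) (suc zero) 1≢1 → ⊥-elim (1≢1 refl)
... | false = inj₂ λ where
  zero       zero       → irrefl G _
  zero       (suc zero) → e
  (suc zero) zero       → trans (Graph.sym G _ _) e
  (suc zero) (suc zero) → irrefl G _

sameColour : ∀ {n} (d : Fin (3 ℕ.+ n) → Bool) → ∃₂ λ a b → a ≢ b × d a ≡ d b
sameColour d with d zero ≟ᵇ d (suc zero) | d zero ≟ᵇ d (suc (suc zero))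
... | yes d₀≡d₁ | _         = zero , suc zero , (λ ()) , d₀≡d₁
... | no _      | yes d₀≡d₂ = zero , suc (suc zero) , (λ ()) , d₀≡d₂
... | no d₀≢d₁  | no d₀≢d₂  =
  suc zero , suc (suc zero) , (λ ()) , not-injective (trans (sym (¬-not d₀≢d₁)) (¬-not d₀≢d₂))

onto-Fin2-distinct : (d : Fin 2 → Bool) → Onto d → d zero ≢ d (suc zero)
onto-Fin2-distinct d onto d₀≡d₁ with onto (not (d zero))
... | zero     , e = not-¬ refl e
... | suc zero , e = not-¬ refl (trans d₀≡d₁ e)

¬onto-Fin2-Fin3 : (c : Fin 2 → Fin 3) → ¬ Onto c
¬onto-Fin2-Fin3 c onto with pigeonhole (s≤s (s≤s (s≤s z≤n))) (proj₁ ∘ onto)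
... | k , l , k<l , same =
  <⇒≢ᶠ k<l (trans (sym (proj₂ (onto k))) (trans (cong c same) (proj₂ (onto l))))

-- Evaluation at x = 1

eval1-zero : ∀ p → (∀ i → coeff p i ≡ 0ℤ) → eval1 p ≡ 0ℤ
eval1-zero []      _ = refl
eval1-zero (c ∷ p) z rewrite z 0 | eval1-zero p (z ∘ suc) = refl

eval1-cong : ∀ p r → p ≈ₚ r → eval1 p ≡ eval1 r
eval1-cong []      r       p≈r = sym (eval1-zero r (sym ∘ p≈r))
eval1-cong (c ∷ p) []      p≈r = eval1-zero (c ∷ p) p≈r
eval1-cong (c ∷ p) (d ∷ r) p≈r = cong₂ _+_ (p≈r 0) (eval1-cong p r (p≈r ∘ suc))

eval1-+ₚ : ∀ p r → eval1 (p +ₚ r) ≡ eval1 p + eval1 r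
eval1-+ₚ []      r       = sym (ℤₚ.+-identityˡ _)
eval1-+ₚ (c ∷ p) []      = sym (ℤₚ.+-identityʳ _)
eval1-+ₚ (c ∷ p) (d ∷ r) = trans (cong (_+_ (c + d)) (eval1-+ₚ p r)) (interchange c d _ _)

eval1-X^ : ∀ n → eval1 (X^ n) ≡ 1ℤ
eval1-X^ zero    = refl
eval1-X^ (suc n) = trans (ℤₚ.+-identityˡ _) (eval1-X^ n)

x+x≡2x : ∀ x → x ℕ.+ x ≡ 2 * x
x+x≡2x = solve-∀

2x+x≡3x : ∀ x → 2 * x ℕ.+ x ≡ 3 * x
2x+x≡3x = solve-∀

3x+3x≡3[2x] : ∀ x → 3 * x ℕ.+ 3 * x ≡ 3 * (2 * x)
3x+3x≡3[2x] = solve-∀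

2[3x]≡3[2x] : ∀ x → 2 * (3 * x) ≡ 3 * (2 * x)
2[3x]≡3[2x] = solve-∀

3x+x≡2[2x] : ∀ x → 3 * x ℕ.+ x ≡ 2 * (2 * x)
3x+x≡2[2x] = solve-∀

module AtOne (q : ∀ n → Graph n → Poly) (isq : IsInterlace q) where

  q₁ : ∀ {n} → Graph n → ℤ
  q₁ {n} G = eval1 (q n G)

  q₁-edgeless : ∀ {n} (G : Graph n) → Edgeless G → q₁ G ≡ 1ℤ
  q₁-edgeless {n} G E = trans (eval1-cong (q n G) (X^ n) (proj₁ isq n G E)) (eval1-X^ n)

  q₁-edge : ∀ {n} (G : Graph (suc n)) a b → adj G a b ≡ true → ∀ {k l} →
    q₁ (G ─ a) ≡ + k → q₁ (pivot G a b ─ b) ≡ + l → q₁ G ≡ + (k ℕ.+ l)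
  q₁-edge {n} G a b ab {k} {l} qk ql = begin
    q₁ G                               ≡⟨ eval1-cong (q (suc n) G) (qₐ +ₚ qᵦ) recursion ⟩
    eval1 (qₐ +ₚ qᵦ)                   ≡⟨ eval1-+ₚ qₐ qᵦ ⟩
    q₁ (G ─ a) + q₁ (pivot G a b ─ b) ≡⟨ cong₂ _+_ qk ql ⟩
    + k + + l                          ≡⟨ ℤₚ.pos-+ k l ⟨
    + (k ℕ.+ l)                        ∎
    where
    open ≡-Reasoning
    qₐ = q n (G ─ a)
    qᵦ = q n (pivot G a b ─ b)
    recursion = proj₂ isq n G a b ab

  q₁-complete : ∀ n (G : Graph (suc n)) → Complete G → q₁ G ≡ + (2 ^ n)
  q₁-complete zero    G _ = q₁-edgeless G λ { zero zero → irrefl G zero }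
  q₁-complete (suc n) G C = trans
    (q₁-edge G zero (suc zero) (C zero (suc zero) λ ())
      (q₁-complete n _ (Patterned-─ G (λ _ → tt) (λ _ _ → true) zero C))
      (q₁-complete n _ (complete-pivot-─ G zero (suc zero) C)))
    (cong +_ (x+x≡2x (2 ^ n)))

  q₁-disjointCliques : ∀ n (G : Graph (2 ℕ.+ n)) d → Onto d → Patterned G d disjointCliques →
    q₁ G ≡ + (2 ^ n)
  q₁-disjointCliques zero G d onto P with two-vertices G
  ... | inj₁ C = ⊥-elim (onto-Fin2-distinct d onto (disjointCliques-same
                   (trans (sym (P zero (suc zero) λ ())) (C zero (suc zero) λ ()))))
  ... | inj₂ E = q₁-edgeless G E
  q₁-disjointCliques (suc n) G d onto P with sameColour d
  ... | a , b , a≢b , da≡db = trans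
    (q₁-edge G a b (twins-adjacent G d P a≢b da≡db)
      (q₁-disjointCliques n _ _ (Onto-─-twin d a≢b da≡db onto)
        (Patterned-─ G d disjointCliques a P))
      (q₁-disjointCliques n _ _ (Onto-─-twin d (a≢b ∘ sym) (sym da≡db) onto)
        (disjointCliques-pivot-─ G P da≡db)))
    (cong +_ (x+x≡2x (2 ^ n)))

  q₁-overlappingCliques : ∀ m (G : Graph (3 ℕ.+ m)) c → Onto c → Patterned G c overlappingCliques →
    q₁ G ≡ + (3 * 2 ^ m)
  q₁-overlappingCliques m G c onto P with onto left | onto shared
  ... | a , ca | b , cb with any? (λ x → (c x ≟ left) ×-dec ¬? (x ≟ a))
  ... | no ¬twin = trans
    (q₁-edge G a b (left-shared-adjacent G c P ca cb)
      (q₁-complete (suc m) _ (lone-left-─ G c P lone))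
      (q₁-disjointCliques m _ _ (proj₁ pivoted) (proj₂ pivoted)))
    (cong +_ (2x+x≡3x (2 ^ m)))
    where
    lone : ∀ x → c x ≡ left → x ≡ a
    lone x cx with x ≟ a
    ... | yes x≡a = x≡a
    ... | no x≢a  = ⊥-elim (¬twin (x , cx , x≢a))
    pivoted = lone-left-pivot-─ G c onto P ca cb lone
  q₁-overlappingCliques zero G c onto P | a , ca | b , cb | yes (a′ , ca′ , a′≢a) =
    ⊥-elim (¬onto-Fin2-Fin3 _ (Onto-─-twin c (a′≢a ∘ sym) (trans ca (sym ca′)) onto))
  q₁-overlappingCliques (suc m) G c onto P | a , ca | b , cb | yes (a′ , ca′ , a′≢a) = trans
    (q₁-edge G a b (left-shared-adjacent G c P ca cb)
      (q₁-overlappingCliques m _ _ (Onto-─-twin c (a′≢a ∘ sym) (trans ca (sym ca′)) onto)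
        (Patterned-─ G c overlappingCliques a P))
      (q₁-overlappingCliques m _ _ (proj₁ pivoted) (proj₂ pivoted)))
    (cong +_ (3x+3x≡3[2x] (2 ^ m)))
    where pivoted = twin-left-pivot-─ G c onto P ca ca′ a′≢a cb

  q₁-twoCliques : ∀ m (G : Graph (3 ℕ.+ m)) → TwoCliques G → q₁ G ≡ + (3 * 2 ^ m)
  q₁-twoCliques m G T =
    q₁-overlappingCliques m G (proj₁ T) (proj₁ (proj₂ T)) (twoCliques-patterned G T)

  -- On n = m + 2 vertices, 2k < 3·2^m says k < ¾·2^(n−1).
  Below : ∀ m → Graph (2 ℕ.+ m) → Set
  Below m G = ∃ λ k → q₁ G ≡ + k × 2 * k ℕ.< 3 * 2 ^ m

  AtMost : ∀ m → Graph (2 ℕ.+ m) → Set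
  AtMost m G = ∃ λ k → q₁ G ≡ + k × 2 * k ℕ.≤ 3 * 2 ^ m

  twoCliques⊎below⇒atMost : ∀ m (G : Graph (2 ℕ.+ m)) → TwoCliques G ⊎ Below m G → AtMost m G
  twoCliques⊎below⇒atMost zero    G (inj₁ T) =
    ⊥-elim (¬onto-Fin2-Fin3 (proj₁ T) (proj₁ (proj₂ T)))
  twoCliques⊎below⇒atMost (suc m) G (inj₁ T) =
    3 * 2 ^ m , q₁-twoCliques m G T , ℕₚ.≤-reflexive (2[3x]≡3[2x] (2 ^ m))
  twoCliques⊎below⇒atMost m       G (inj₂ (k , qk , k<)) = k , qk , ℕₚ.<⇒≤ k<

  edgeless-below : ∀ m (G : Graph (2 ℕ.+ m)) → Edgeless G → Below m G
  edgeless-below m G E = 1 , q₁-edgeless G E , ℕₚ.*-monoʳ-≤ 3 (ℕₚ.m^n>0 2 m)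

  below-edge : ∀ m (G : Graph (3 ℕ.+ m)) a b → adj G a b ≡ true → ∀ {k l} →
    q₁ (G ─ a) ≡ + k → q₁ (pivot G a b ─ b) ≡ + l →
    2 * k ℕ.+ 2 * l ℕ.< 3 * 2 ^ m ℕ.+ 3 * 2 ^ m → Below (suc m) G
  below-edge m G a b ab {k} {l} qk ql lt = k ℕ.+ l , q₁-edge G a b ab qk ql ,
    subst₂ ℕ._<_ (sym (ℕₚ.*-distribˡ-+ 2 k l)) (3x+3x≡3[2x] (2 ^ m)) lt

  below-edgeˡ : ∀ m (G : Graph (3 ℕ.+ m)) a b → adj G a b ≡ true →
    Below m (G ─ a) → AtMost m (pivot G a b ─ b) → Below (suc m) G
  below-edgeˡ m G a b ab (k , qk , k<) (l , ql , l≤) =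
    below-edge m G a b ab qk ql (ℕₚ.+-mono-<-≤ k< l≤)

  below-edgeʳ : ∀ m (G : Graph (3 ℕ.+ m)) a b → adj G a b ≡ true →
    AtMost m (G ─ a) → Below m (pivot G a b ─ b) → Below (suc m) G
  below-edgeʳ m G a b ab (k , qk , k≤) (l , ql , l<) =
    below-edge m G a b ab qk ql (ℕₚ.+-mono-≤-< k≤ l<)

  Trichotomy : ∀ m → Graph (2 ℕ.+ m) → Set
  Trichotomy m G = Complete G ⊎ TwoCliques G ⊎ Below m G

  trichotomy : ∀ m (G : Graph (2 ℕ.+ m)) → Trichotomy m G
  trichotomy zero G with two-vertices G
  ... | inj₁ C = inj₁ C
  ... | inj₂ E = inj₂ (inj₂ (edgeless-below zero G E))
  trichotomy (suc m) G with universal? G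
  ... | yes (u , U) = withUniversal (trichotomy m (G ─ u)) (trichotomy m (pivot G u b ─ b))
    where
    b = proj₁ (another u)
    b≢u = proj₂ (another u)
    withUniversal : Trichotomy m (G ─ u) → Trichotomy m (pivot G u b ─ b) → Trichotomy (suc m) G
    withUniversal (inj₁ C)        _        = inj₁ (complete-insertUniversal G u U C)
    withUniversal (inj₂ (inj₁ T)) _        = inj₂ (inj₁ (twoCliques-insertUniversal G u U T))
    withUniversal (inj₂ (inj₂ B)) (inj₁ C) = map₂ inj₁ (universal-pivot-complete G u b U b≢u C)
    withUniversal (inj₂ (inj₂ B)) (inj₂ r) =
      inj₂ (inj₂ (below-edgeˡ m G u b (U b b≢u) B (twoCliques⊎below⇒atMost m _ r)))
  ... | no ¬U with edge? G
  ...   | no ¬e = inj₂ (inj₂ (edgeless-below (suc m) G λ a b → ¬-not λ ab → ¬e (a , b , ab)))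
  ...   | yes (a , b , ab) =
    withoutUniversal (trichotomy m (G ─ a)) (trichotomy m (pivot G a b ─ b))
    where
    withoutUniversal :
      Trichotomy m (G ─ a) → Trichotomy m (pivot G a b ─ b) → Trichotomy (suc m) G
    withoutUniversal (inj₁ C) _ =
      ⊥-elim (¬U (b , complete-─⇒universal G a b C (trans (Graph.sym G b a) ab)))
    withoutUniversal _ (inj₁ C) = ⊥-elim (¬U (a , complete-pivot-─⇒universal G a b C ab))
    withoutUniversal (inj₂ (inj₁ T₁)) (inj₂ (inj₁ T₂)) = ⊥-elim (¬U (universal-─-pivot G a b ab
      (twoCliques⇒universal (G ─ a) T₁) (twoCliques⇒universal (pivot G a b ─ b) T₂)))
    withoutUniversal (inj₂ (inj₂ B)) (inj₂ r) =
      inj₂ (inj₂ (below-edgeˡ m G a b ab B (twoCliques⊎below⇒atMost m _ r)))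
    withoutUniversal (inj₂ l) (inj₂ (inj₂ B)) =
      inj₂ (inj₂ (below-edgeʳ m G a b ab (twoCliques⊎below⇒atMost m _ l) B))

  below⇒< : ∀ m (G : Graph (3 ℕ.+ m)) → Below (suc m) G → q₁ G < + (3 * 2 ^ m)
  below⇒< m G (k , qk , k<) = subst (_< + (3 * 2 ^ m)) (sym qk)
    (ℤ.+<+ (ℕₚ.*-cancelˡ-< 2 k _ (subst (2 * k ℕ.<_) (sym (2[3x]≡3[2x] (2 ^ m))) k<)))

  twoCliques<complete : ∀ m → + (3 * 2 ^ m) < + (2 ^ (2 ℕ.+ m))
  twoCliques<complete m =
    ℤ.+<+ (subst (3 * 2 ^ m ℕ.<_) (3x+x≡2[2x] (2 ^ m)) (ℕₚ.m<m+n _ (ℕₚ.m^n>0 2 m)))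

  above⇒complete : ∀ m (G : Graph (3 ℕ.+ m)) → + (3 * 2 ^ m) < q₁ G → Complete G
  above⇒complete m G s<q with trichotomy (suc m) G
  ... | inj₁ C        = C
  ... | inj₂ (inj₁ T) = ⊥-elim (ℤₚ.<-irrefl (sym (q₁-twoCliques m G T)) s<q)
  ... | inj₂ (inj₂ B) = ⊥-elim (ℤₚ.<-asym (below⇒< m G B) s<q)

  q₁≡⇒twoCliques : ∀ m (G : Graph (3 ℕ.+ m)) → q₁ G ≡ + (3 * 2 ^ m) → TwoCliques G
  q₁≡⇒twoCliques m G q≡s with trichotomy (suc m) G
  ... | inj₁ C        = ⊥-elim (ℤₚ.<-irrefl (trans (sym q≡s) (q₁-complete (2 ℕ.+ m) G C))
                                            (twoCliques<complete m))
  ... | inj₂ (inj₁ T) = T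
  ... | inj₂ (inj₂ B) = ⊥-elim (ℤₚ.<-irrefl q≡s (below⇒< m G B))

threeParts : ∀ {m} → Fin (3 ℕ.+ m) → Fin 3
threeParts zero          = left
threeParts (suc zero)    = right
threeParts (suc (suc _)) = shared

threeParts-onto : ∀ {m} → Onto (threeParts {m})
threeParts-onto left   = zero , refl
threeParts-onto shared = suc (suc zero) , refl
threeParts-onto right  = suc zero , refl

proposition52 : (q : ∀ n → Graph n → Poly) → IsInterlace q →
    ∀ n → 3 ≤ n →
      let s = + (3 * 2 ^ (n ∸ 3)) in
      (∃ λ (G : Graph n) → eval1 (q n G) ≡ s)
      × (∃ λ (G : Graph n) → s < eval1 (q n G))
      × (∀ (G H : Graph n) → s < eval1 (q n G) → s < eval1 (q n H) →
           eval1 (q n G) ≡ eval1 (q n H))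
      × (∀ (G : Graph n) → (eval1 (q n G) ≡ s) ⇔ TwoCliques G)
proposition52 q isq zero                ()
proposition52 q isq (suc zero)          (s≤s ())
proposition52 q isq (suc (suc zero))    (s≤s (s≤s ()))
proposition52 q isq (suc (suc (suc m))) _ =
    (twoCliquesGraph , q₁-overlappingCliques m _ threeParts threeParts-onto
                         (patternGraph-patterned _ _ overlappingCliques-sym))
  , (completeGraph , subst (+ (3 * 2 ^ m) <_)
                       (sym (q₁-complete _ _ (patternGraph-patterned (λ _ → tt) _ λ _ _ → refl)))
                       (twoCliques<complete m))
  , (λ G H s<G s<H → trans (q₁-complete _ G (above⇒complete m G s<G))
                           (sym (q₁-complete _ H (above⇒complete m H s<H))))
  , (λ G → mk⇔ (q₁≡⇒twoCliques m G) (q₁-twoCliques m G))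
  where
  open AtOne q isq
  twoCliquesGraph = patternGraph threeParts overlappingCliques overlappingCliques-sym
  completeGraph   = patternGraph (λ (_ : Fin (3 ℕ.+ m)) → tt) (λ _ _ → true) (λ _ _ → refl)
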